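{- Let $G=\prod_l\mathbb{Z}_l^{d_l}$ be a finite Abelian group, where $l$ runs over all prime powers. Let $q$ be a prime power and write $G=\prod_{l\mid q}\mathbb{Z}_l^{d_l}\times G'$ (where $G'$ is the product of the remaining factors). Let $k_+\ge k_-\ge0$ and $t\ge1$ be integers. If $G\ge[-k_-,k_+]^*\diamond_t S$ for some $S\in G^n$, then $G'\ge\left[-\lfloor k_-/q\rfloor,\lfloor k_+/q\rfloor\right]^*\diamond_t S'$ for some $S'\in (G')^n$ (so $|S'|=|S|$).
   Context: $[a,b]^*=\{a,\dots,b\}\setminus\{0\}$. For a finite Abelian group $G$, finite $M\subseteq\mathbb{Z}\setminus\{0\}$ and $S=(s_1,\dots,s_n)\in G^n$ (a "splitter set" of size $n$), $G\ge M\diamond_t S$ means the elements $\sum_i e_is_i$, for $\mathbf{e}\in(M\cup\{0\})^n$ with $1\le\mathrm{wt}(\mathbf{e})\le t$ (Hamming weight), are nonzero and pairwise distinct for distinct $\mathbf{e}$. -}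

module Defs where

open import Data.Nat as ℕ using (ℕ; zero; suc)
open import Data.Nat.Primality using (Prime)
open import Data.Nat.Divisibility using (_∣?_)
open import Data.Integer as ℤ using (ℤ; +_; -[1+_])
open import Data.Integer.Divisibility as ℤD using ()
open import Data.List using (List; []; _∷_; filter)
open import Data.Vec using (Vec; []; _∷_)
open import Data.Product using (_×_; _,_; ∃; ∃-syntax)
open import Data.Unit using (⊤; tt)
open import Relation.Nullary using (¬_)
open import Relation.Nullary.Decidable using (¬?)
open import Relation.Binary.PropositionalEquality using (_≡_)
open import Data.Sum using (_⊎_)

IsPrimePower : ℕ → Set
IsPrimePower l = ∃[ p ] ∃[ k ] (Prime p × 1 ℕ.≤ k × l ≡ p ℕ.^ k)

-- A finite Abelian group  ∏_{m ∈ ms} ℤ_m  is described by the list of its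
-- cyclic factor orders (with multiplicity).  Elements are tuples of integer
-- representatives; equality in the group is componentwise congruence.
Elem : List ℕ → Set
Elem [] = ⊤
Elem (m ∷ ms) = ℤ × Elem ms

zeroG : (ms : List ℕ) → Elem ms
zeroG [] = tt
zeroG (m ∷ ms) = + 0 , zeroG ms

addG : (ms : List ℕ) → Elem ms → Elem ms → Elem ms
addG [] _ _ = tt
addG (m ∷ ms) (x , xs) (y , ys) = x ℤ.+ y , addG ms xs ys

scaleG : (ms : List ℕ) → ℤ → Elem ms → Elem ms
scaleG [] _ _ = tt
scaleG (m ∷ ms) c (x , xs) = c ℤ.* x , scaleG ms c xs

EqG : (ms : List ℕ) → Elem ms → Elem ms → Set
EqG [] _ _ = ⊤
EqG (m ∷ ms) (x , xs) (y , ys) = ((+ m) ℤD.∣ (x ℤ.- y)) × EqG ms xs ys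

lincomb : (ms : List ℕ) {n : ℕ} → Vec ℤ n → Vec (Elem ms) n → Elem ms
lincomb ms [] [] = zeroG ms
lincomb ms (e ∷ es) (s ∷ ss) = addG ms (scaleG ms e s) (lincomb ms es ss)

wt : {n : ℕ} → Vec ℤ n → ℕ
wt [] = 0
wt (+ zero ∷ es) = wt es
wt (+ suc _ ∷ es) = suc (wt es)
wt (-[1+ _ ] ∷ es) = suc (wt es)

Interval* : ℤ → ℤ → ℤ → Set
Interval* a b z = a ℤ.≤ z × z ℤ.≤ b × ¬ (z ≡ + 0)

AllIn : (ℤ → Set) → {n : ℕ} → Vec ℤ n → Set
AllIn M [] = ⊤
AllIn M (e ∷ es) = (e ≡ + 0 ⊎ M e) × AllIn M es

Splitter : (ms : List ℕ) → (M : ℤ → Set) → (t : ℕ) → {n : ℕ} → Vec (Elem ms) n → Set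
Splitter ms M t {n} S =
  ∀ (e e' : Vec ℤ n) →
    AllIn M e → 1 ℕ.≤ wt e → wt e ℕ.≤ t →
    AllIn M e' → 1 ℕ.≤ wt e' → wt e' ℕ.≤ t →
    ¬ EqG ms (lincomb ms e S) (zeroG ms) ×
    (¬ (e ≡ e') → ¬ EqG ms (lincomb ms e S) (lincomb ms e' S))

G′ : ℕ → List ℕ → List ℕ
G′ q ms = filter (λ l → ¬? (l ∣? q)) ms

{-# OPTIONS --safe #-}
-- Multiplication by q kills every factor ℤ_l with l ∣ q.  So take for S′ the
-- image of q·S in G′: if two coefficient vectors e, e′ give the same element of
-- G′, then both Σ e_i q s_i and Σ e′_i q s_i are divisible by q, hence also agree
-- in the removed factors, i.e. in G.  Since e ↦ q·e maps [-⌊k₋/q⌋, ⌊k₊/q⌋]*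
-- into [-k₋, k₊]*, injectively and preserving weight, this contradicts the
-- splitter property of S.
module Submission where

open import Defs
open import Data.Nat using (ℕ; _≤_; _/_; NonZero)
open import Data.Integer using (+_; -_)
open import Data.List using (List)
open import Data.List.Relation.Unary.All using (All)
open import Data.Vec using (Vec)
open import Data.Product using (∃)

open import Data.Nat as ℕ using (zero; suc)
open import Data.Nat.Divisibility using (_∣?_; _∣0)
open import Data.Nat.DivMod using (m/n*n≤m)
open import Data.Integer as ℤ using (ℤ; -[1+_])
import Data.Integer.Properties as ℤ
open import Data.Integer.Divisibility.Signed
  using (_∣_; ∣-refl; ∣-trans; ∣ᵤ⇒∣; ∣⇒∣ᵤ; ∣m⇒∣m*n; ∣n⇒∣m*n; ∣m∣n⇒∣m+n; ∣m∣n⇒∣m-n)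
open import Data.List using ([]; _∷_)
open import Data.Vec using ([]; _∷_; map)
import Data.Vec.Properties as Vec
open import Data.Vec.Relation.Unary.All as VecAll using ([]; _∷_)
open import Data.Vec.Relation.Unary.All.Properties using (map⁺)
open import Data.Product using (_×_; _,_; proj₁; proj₂)
open import Data.Sum using (inj₁; inj₂)
open import Data.Unit using (⊤; tt)
open import Data.Empty using (⊥-elim)
open import Function using (_∘_; Injective)
open import Relation.Nullary using (yes; no)
open import Relation.Binary.PropositionalEquality

wt-∷-≢0 : ∀ {n} {x : ℤ} (xs : Vec ℤ n) → x ≢ + 0 → wt (x ∷ xs) ≡ suc (wt xs)
wt-∷-≢0 {x = + zero}    xs x≢0 = ⊥-elim (x≢0 refl)
wt-∷-≢0 {x = + suc _}   xs _   = refl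
wt-∷-≢0 {x = -[1+ _ ]} xs _   = refl

wt-map : (f : ℤ → ℤ) → Injective _≡_ _≡_ f → f (+ 0) ≡ + 0 →
         ∀ {n} (e : Vec ℤ n) → wt (map f e) ≡ wt e
wt-map f f-inj f0 [] = refl
wt-map f f-inj f0 (x ∷ xs) with x ℤ.≟ + 0
... | yes refl rewrite f0 = wt-map f f-inj f0 xs
... | no x≢0 = begin
  wt (f x ∷ map f xs)  ≡⟨ wt-∷-≢0 (map f xs) (x≢0 ∘ f-inj ∘ (λ fx≡0 → trans fx≡0 (sym f0))) ⟩
  suc (wt (map f xs))  ≡⟨ cong suc (wt-map f f-inj f0 xs) ⟩
  suc (wt xs)          ≡⟨ wt-∷-≢0 xs x≢0 ⟨
  wt (x ∷ xs)          ∎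
  where open ≡-Reasoning

map-injective : {A B : Set} {f : A → B} → Injective _≡_ _≡_ f →
                ∀ {n} {xs ys : Vec A n} → map f xs ≡ map f ys → xs ≡ ys
map-injective f-inj {xs = []}     {[]}     _  = refl
map-injective f-inj {xs = x ∷ xs} {y ∷ ys} eq =
  cong₂ _∷_ (f-inj (Vec.∷-injectiveˡ eq)) (map-injective f-inj (Vec.∷-injectiveʳ eq))

AllIn-map : {M N : ℤ → Set} {f : ℤ → ℤ} → f (+ 0) ≡ + 0 → (∀ {x} → M x → N (f x)) →
            ∀ {n} {e : Vec ℤ n} → AllIn M e → AllIn N (map f e)
AllIn-map f0 M⇒N {e = []}    tt              = tt
AllIn-map f0 M⇒N {e = _ ∷ _} (inj₁ refl , ps) = inj₁ f0 , AllIn-map f0 M⇒N ps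
AllIn-map f0 M⇒N {e = _ ∷ _} (inj₂ Mx , ps)   = inj₂ (M⇒N Mx) , AllIn-map f0 M⇒N ps

Splitter-pullback :
  ∀ {G H : List ℕ} {M N : ℤ → Set} {t n} {S : Vec (Elem G) n} {T : Vec (Elem H) n}
  (f : ℤ → ℤ) → Injective _≡_ _≡_ f → f (+ 0) ≡ + 0 → (∀ {x} → N x → M (f x)) →
  (∀ e → EqG H (lincomb H e T) (zeroG H) → EqG G (lincomb G (map f e) S) (zeroG G)) →
  (∀ e e′ → EqG H (lincomb H e T) (lincomb H e′ T) →
            EqG G (lincomb G (map f e) S) (lincomb G (map f e′) S)) →
  Splitter G M t S → Splitter H N t T
Splitter-pullback {t = t} f f-inj f0 N⇒M zero-lifts collision-lifts splits
                  e e′ Ne 1≤∣e∣ ∣e∣≤t Ne′ 1≤∣e′∣ ∣e′∣≤t =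
  let nonzero , distinct =
        splits (map f e) (map f e′)
               (AllIn-map f0 N⇒M Ne)  (subst (1 ≤_) (sym (wt-f e))  1≤∣e∣)  (subst (_≤ t) (sym (wt-f e))  ∣e∣≤t)
               (AllIn-map f0 N⇒M Ne′) (subst (1 ≤_) (sym (wt-f e′)) 1≤∣e′∣) (subst (_≤ t) (sym (wt-f e′)) ∣e′∣≤t)
  in (λ e≈0 → nonzero (zero-lifts e e≈0)) ,
     (λ e≢e′ e≈e′ → distinct (e≢e′ ∘ map-injective f-inj) (collision-lifts e e′ e≈e′))
  where
    wt-f : ∀ {n} (e : Vec ℤ n) → wt (map f e) ≡ wt e
    wt-f = wt-map f f-inj f0

scaleG-scaleG : ∀ ms c d (x : Elem ms) → scaleG ms c (scaleG ms d x) ≡ scaleG ms (c ℤ.* d) x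
scaleG-scaleG []       c d x        = refl
scaleG-scaleG (_ ∷ ms) c d (x , xs) = cong₂ _,_ (sym (ℤ.*-assoc c d x)) (scaleG-scaleG ms c d xs)

lincomb-map-scaleG : ∀ ms {n} c (e : Vec ℤ n) (S : Vec (Elem ms) n) →
                     lincomb ms e (map (scaleG ms c) S) ≡ lincomb ms (map (ℤ._* c) e) S
lincomb-map-scaleG ms c []       []       = refl
lincomb-map-scaleG ms c (x ∷ xs) (s ∷ ss) =
  cong₂ (addG ms) (scaleG-scaleG ms x c s) (lincomb-map-scaleG ms c xs ss)

module _ (q : ℕ) where

  proj′ : (ms : List ℕ) → Elem ms → Elem (G′ q ms)
  proj′ []       _ = tt
  proj′ (l ∷ ms) (x , xs) with l ∣? q
  ... | yes _ = proj′ ms xs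
  ... | no _  = x , proj′ ms xs

  proj′-zeroG : ∀ ms → proj′ ms (zeroG ms) ≡ zeroG (G′ q ms)
  proj′-zeroG []       = refl
  proj′-zeroG (l ∷ ms) with l ∣? q
  ... | yes _ = proj′-zeroG ms
  ... | no _  = cong (+ 0 ,_) (proj′-zeroG ms)

  proj′-addG : ∀ ms (x y : Elem ms) →
               proj′ ms (addG ms x y) ≡ addG (G′ q ms) (proj′ ms x) (proj′ ms y)
  proj′-addG []       _        _        = refl
  proj′-addG (l ∷ ms) (x , xs) (y , ys) with l ∣? q
  ... | yes _ = proj′-addG ms xs ys
  ... | no _  = cong (x ℤ.+ y ,_) (proj′-addG ms xs ys)

  proj′-scaleG : ∀ ms c (x : Elem ms) → proj′ ms (scaleG ms c x) ≡ scaleG (G′ q ms) c (proj′ ms x)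
  proj′-scaleG []       _ _        = refl
  proj′-scaleG (l ∷ ms) c (x , xs) with l ∣? q
  ... | yes _ = proj′-scaleG ms c xs
  ... | no _  = cong (c ℤ.* x ,_) (proj′-scaleG ms c xs)

  proj′-lincomb : ∀ ms {n} (e : Vec ℤ n) (S : Vec (Elem ms) n) →
                  lincomb (G′ q ms) e (map (proj′ ms) S) ≡ proj′ ms (lincomb ms e S)
  proj′-lincomb ms []       []       = sym (proj′-zeroG ms)
  proj′-lincomb ms (x ∷ xs) (s ∷ ss) = begin
    addG G (scaleG G x (proj′ ms s)) (lincomb G xs (map (proj′ ms) ss))
      ≡⟨ cong₂ (addG G) (sym (proj′-scaleG ms x s)) (proj′-lincomb ms xs ss) ⟩
    addG G (proj′ ms (scaleG ms x s)) (proj′ ms (lincomb ms xs ss))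
      ≡⟨ proj′-addG ms _ _ ⟨
    proj′ ms (lincomb ms (x ∷ xs) (s ∷ ss)) ∎
    where
      open ≡-Reasoning
      G = G′ q ms

  DivisibleBy : (ms : List ℕ) → Elem ms → Set
  DivisibleBy []       _        = ⊤
  DivisibleBy (_ ∷ ms) (x , xs) = + q ∣ x × DivisibleBy ms xs

  DivisibleBy-zeroG : ∀ ms → DivisibleBy ms (zeroG ms)
  DivisibleBy-zeroG []       = tt
  DivisibleBy-zeroG (_ ∷ ms) = ∣ᵤ⇒∣ (q ∣0) , DivisibleBy-zeroG ms

  DivisibleBy-addG : ∀ ms {x y : Elem ms} → DivisibleBy ms x → DivisibleBy ms y →
                     DivisibleBy ms (addG ms x y)
  DivisibleBy-addG []       _        _        = tt
  DivisibleBy-addG (_ ∷ ms) (p , ps) (r , rs) = ∣m∣n⇒∣m+n p r , DivisibleBy-addG ms ps rs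

  DivisibleBy-scaleG : ∀ ms c {x : Elem ms} → DivisibleBy ms x → DivisibleBy ms (scaleG ms c x)
  DivisibleBy-scaleG []       c _        = tt
  DivisibleBy-scaleG (_ ∷ ms) c (p , ps) = ∣n⇒∣m*n c p , DivisibleBy-scaleG ms c ps

  DivisibleBy-scaleG-q : ∀ ms (x : Elem ms) → DivisibleBy ms (scaleG ms (+ q) x)
  DivisibleBy-scaleG-q []       _        = tt
  DivisibleBy-scaleG-q (_ ∷ ms) (x , xs) = ∣m⇒∣m*n x ∣-refl , DivisibleBy-scaleG-q ms xs

  DivisibleBy-lincomb : ∀ ms {n} (e : Vec ℤ n) {S : Vec (Elem ms) n} →
                        VecAll.All (DivisibleBy ms) S → DivisibleBy ms (lincomb ms e S)
  DivisibleBy-lincomb ms []       []       = DivisibleBy-zeroG ms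
  DivisibleBy-lincomb ms (x ∷ xs) (p ∷ ps) =
    DivisibleBy-addG ms (DivisibleBy-scaleG ms x p) (DivisibleBy-lincomb ms xs ps)

  proj′-reflects-EqG : ∀ ms {x y : Elem ms} → DivisibleBy ms x → DivisibleBy ms y →
                       EqG (G′ q ms) (proj′ ms x) (proj′ ms y) → EqG ms x y
  proj′-reflects-EqG []       _        _        _ = tt
  proj′-reflects-EqG (l ∷ ms) {x , _} {y , _} (p , ps) (r , rs) x≈y with l ∣? q
  ... | yes l∣q = ∣⇒∣ᵤ (∣-trans (∣ᵤ⇒∣ {+ l} {+ q} l∣q) (∣m∣n⇒∣m-n p r))
                , proj′-reflects-EqG ms ps rs x≈y
  ... | no _    = proj₁ x≈y , proj′-reflects-EqG ms ps rs (proj₂ x≈y)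

module _ (q : ℕ) .{{_ : NonZero q}} where

  [k/q]*q≤k : ∀ k → + (k / q) ℤ.* + q ℤ.≤ + k
  [k/q]*q≤k k = begin
    + (k / q) ℤ.* + q  ≡⟨ ℤ.pos-* (k / q) q ⟨
    + (k / q ℕ.* q)    ≤⟨ ℤ.+≤+ (m/n*n≤m k q) ⟩
    + k                ∎
    where open ℤ.≤-Reasoning

  Interval*-*q : ∀ km kp {x} → Interval* (- (+ (km / q))) (+ (kp / q)) x →
                 Interval* (- (+ km)) (+ kp) (x ℤ.* + q)
  Interval*-*q km kp {x} (lo , hi , x≢0) = lo′ , hi′ , x≢0 ∘ ℤ.*-cancelʳ-≡ x (+ 0) (+ q)
    where
      open ℤ.≤-Reasoning
      lo′ = begin
        - (+ km)                      ≤⟨ ℤ.neg-mono-≤ ([k/q]*q≤k km) ⟩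
        - (+ (km / q) ℤ.* + q)        ≡⟨ ℤ.neg-distribˡ-* (+ (km / q)) (+ q) ⟩
        - (+ (km / q)) ℤ.* + q        ≤⟨ ℤ.*-monoʳ-≤-nonNeg (+ q) lo ⟩
        x ℤ.* + q                     ∎
      hi′ = begin
        x ℤ.* + q                     ≤⟨ ℤ.*-monoʳ-≤-nonNeg (+ q) hi ⟩
        + (kp / q) ℤ.* + q            ≤⟨ [k/q]*q≤k kp ⟩
        + kp                          ∎

lemma11 : (ms : List ℕ) → All IsPrimePower ms →
          (q : ℕ) → IsPrimePower q → .{{_ : NonZero q}} →
          (kp km t : ℕ) → km ≤ kp → 1 ≤ t →
          (n : ℕ) → (S : Vec (Elem ms) n) →
          Splitter ms (Interval* (- (+ km)) (+ kp)) t S →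
          ∃ λ (S′ : Vec (Elem (G′ q ms)) n) →
            Splitter (G′ q ms) (Interval* (- (+ (km / q))) (+ (kp / q))) t S′
lemma11 ms _ q _ kp km t _ _ n S splits =
  S′ , Splitter-pullback (ℤ._* + q) (ℤ.*-cancelʳ-≡ _ _ (+ q)) refl (Interval*-*q q km kp)
                         zero-lifts collision-lifts splits
  where
    qS = map (scaleG ms (+ q)) S
    S′ = map (proj′ q ms) qS

    qS-divisible : ∀ e → DivisibleBy q ms (lincomb ms e qS)
    qS-divisible e = DivisibleBy-lincomb q ms e (map⁺ (VecAll.universal (DivisibleBy-scaleG-q q ms) S))

    to-qS : ∀ e → lincomb ms (map (ℤ._* + q) e) S ≡ lincomb ms e qS
    to-qS e = sym (lincomb-map-scaleG ms (+ q) e S)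

    zero-lifts : ∀ e → EqG (G′ q ms) (lincomb (G′ q ms) e S′) (zeroG (G′ q ms)) →
                 EqG ms (lincomb ms (map (ℤ._* + q) e) S) (zeroG ms)
    zero-lifts e rewrite proj′-lincomb q ms e qS | to-qS e | sym (proj′-zeroG q ms) =
      proj′-reflects-EqG q ms (qS-divisible e) (DivisibleBy-zeroG q ms)

    collision-lifts : ∀ e e′ → EqG (G′ q ms) (lincomb (G′ q ms) e S′) (lincomb (G′ q ms) e′ S′) →
                      EqG ms (lincomb ms (map (ℤ._* + q) e) S) (lincomb ms (map (ℤ._* + q) e′) S)
    collision-lifts e e′ rewrite proj′-lincomb q ms e qS | proj′-lincomb q ms e′ qS | to-qS e | to-qS e′ =
      proj′-reflects-EqG q ms (qS-divisible e) (qS-divisible e′)
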